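{- Let $G$ be a finite connected graph with a fixed vertex $v_1$ such that $G - v_1$ is connected. Let $u \in V(G)$ with $u \neq v_1$, and let $G^+$ be the graph obtained from $G$ by adding a new vertex $z$ and the edge $zu$. Then $$\delta_{G^+}(z) = \delta_{G^+}(u) + 1 = \delta_G(u) + 1,$$ where for a graph $H$ containing $v_1$ and a vertex $x \in V(H)\setminus\{v_1\}$ we write $\delta_H(x) = t_H(x) - t_{H-v_1}(x)$.
   Context: All graphs are finite, simple and undirected. For a connected graph $H$ and $x \in V(H)$, the transmission of $x$ is $t_H(x)=\sum_{y\in V(H)}\mathrm{dist}_H(x,y)$. -}

module Defs where

open import Data.Nat using (ℕ; zero; suc; _+_)
open import Data.Bool using (Bool; true; false; _∨_; _∧_; if_then_else_)
open import Data.Fin using (Fin; zero; suc; punchIn; punchOut)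
open import Data.Fin.Properties using (_≟_)
open import Data.List using (List; map; allFin)
open import Data.Bool.ListAction using (any)
open import Data.Nat.ListAction using (sum)
open import Data.Integer using (ℤ; +_; _-_)
open import Data.Product using (∃)
open import Relation.Nullary.Decidable using (⌊_⌋)
open import Relation.Binary.PropositionalEquality using (_≡_; _≢_; refl; sym)

record Graph (n : ℕ) : Set where
  field
    adj     : Fin n → Fin n → Bool
    adj-sym : ∀ x y → adj x y ≡ adj y x
    adj-irr : ∀ x → adj x x ≡ false
open Graph public

data Walk {n : ℕ} (G : Graph n) : Fin n → Fin n → ℕ → Set where
  stop : ∀ x → Walk G x x zero
  step : ∀ {x y w k} → adj G x y ≡ true → Walk G y w k → Walk G x w (suc k)

Connected : ∀ {n} → Graph n → Set
Connected {n} G = ∀ (x y : Fin n) → ∃ λ k → Walk G x y k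

reach : ∀ {n} → Graph n → ℕ → Fin n → Fin n → Bool
reach G zero    x y = ⌊ x ≟ y ⌋
reach {n} G (suc k) x y = reach G k x y ∨ any (λ w → reach G k x w ∧ adj G w y) (allFin n)

-- least k in [start, start + fuel) with p k; returns start + fuel if none.
least : (ℕ → Bool) → ℕ → ℕ → ℕ
least p start zero       = start
least p start (suc fuel) = if p start then start else least p (suc start) fuel

-- Shortest-path distance: the least k such that y is reachable from x by a walk
-- of length ≤ k (for connected graphs on n vertices this is < n, so the search
-- bound n is never hit).
dist : ∀ {n} → Graph n → Fin n → Fin n → ℕ
dist {n} G x y = least (λ k → reach G k x y) 0 n

transmission : ∀ {n} → Graph n → Fin n → ℕ
transmission {n} G x = sum (map (dist G x) (allFin n))

deleteVertex : ∀ {n} → Graph (suc n) → Fin (suc n) → Graph n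
deleteVertex G v = record
  { adj     = λ i j → adj G (punchIn v i) (punchIn v j)
  ; adj-sym = λ i j → adj-sym G (punchIn v i) (punchIn v j)
  ; adj-irr = λ i → adj-irr G (punchIn v i)
  }

δ : ∀ {n} → (H : Graph (suc n)) → (v x : Fin (suc n)) → v ≢ x → ℤ
δ H v x v≢x = + transmission H x - + transmission (deleteVertex H v) (punchOut v≢x)

-- G⁺: add a new vertex z (index zero) adjacent only to u; old vertex i becomes suc i.
pendAdj : ∀ {n} → Graph n → Fin n → Fin (suc n) → Fin (suc n) → Bool
pendAdj G u zero    zero    = false
pendAdj G u zero    (suc j) = ⌊ j ≟ u ⌋
pendAdj G u (suc i) zero    = ⌊ i ≟ u ⌋
pendAdj G u (suc i) (suc j) = adj G i j

addPendant : ∀ {n} → Graph n → Fin n → Graph (suc n)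
addPendant G u = record
  { adj     = pendAdj G u
  ; adj-sym = symm
  ; adj-irr = irr
  }
  where
  symm : ∀ x y → pendAdj G u x y ≡ pendAdj G u y x
  symm zero zero = refl
  symm zero (suc j) = refl
  symm (suc i) zero = refl
  symm (suc i) (suc j) = adj-sym G i j
  irr : ∀ x → pendAdj G u x x ≡ false
  irr zero = refl
  irr (suc i) = adj-irr G i

-- Attaching a pendant vertex z to u changes distances in a transparent way:
-- d(z, x) = 1 + d(u, x) for every old vertex x, and distances between old
-- vertices are unchanged, because a shortest walk never enters the leaf z.
-- Hence t_{G⁺}(z) = |V(G)| + t_G(u) and t_{G⁺}(u) = 1 + t_G(u).  Deleting v₁
-- commutes with attaching z, so the same formulas hold in G⁺ - v₁, with
-- |V(G)| - 1 in place of |V(G)|, and subtracting gives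
-- δ_{G⁺}(z) = δ_G(u) + 1 and δ_{G⁺}(u) = δ_G(u).
module Submission where

open import Defs
open import Data.Bool using (Bool; true; false; T; _∨_; _∧_)
open import Data.Bool.Properties using (T-≡; T-∧; T-∨; ∨-identityʳ; ∧-identityʳ; ∧-zeroʳ)
open import Data.Bool.ListAction using (any; or)
open import Data.Nat as ℕ using (ℕ; zero; suc; _∸_; _≤_; _<_; z≤n; s≤s)
open import Data.Nat.Properties
  using ( +-commutativeSemigroup; ≤-trans; <⇒≤; <-≤-trans; <-irrefl; ≤∧≢⇒<; ≮⇒≥; _<?_
        ; +-suc; +-identityʳ; +-monoˡ-<; m+[n∸m]≡n)
open import Algebra.Properties.CommutativeSemigroup (+-commutativeSemigroup) using (x∙yz≈y∙xz)
open import Data.Nat.Induction using (<-wellFounded)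
open import Data.Nat.ListAction using (sum)
open import Data.Fin using (Fin; zero; suc; toℕ; punchIn; punchOut)
open import Data.Fin.Properties
  using (suc-injective; _≟_; pigeonhole; toℕ≤pred[n]; punchOut-cong; punchIn-punchOut; punchOut-punchIn)
open import Data.Integer using (_+_; _-_; +_; 1ℤ)
open import Data.Integer.Properties using (pos-+; m-n≡m⊖n; +-cancelˡ-⊖)
open import Data.Integer.Tactic.RingSolver using (solve-∀)
open import Data.List using (List; []; _∷_; map; length; allFin)
open import Data.List.Properties using (map-tabulate; map-cong; length-tabulate)
open import Data.List.Membership.Propositional using (lose)
open import Data.List.Membership.Propositional.Properties using (∈-allFin)
open import Data.List.Relation.Unary.Any using (satisfied)
open import Data.List.Relation.Unary.Any.Properties using (any⁺; any⁻)
open import Data.Product using (∃; _×_; _,_; proj₂)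
open import Data.Sum using (inj₁; inj₂)
open import Function using (_∘_; id; _⇔_; mk⇔; Equivalence)
open import Induction.WellFounded using (Acc; acc)
open import Relation.Nullary using (yes; no; contradiction)
open import Relation.Nullary.Decidable using (Dec; ⌊_⌋; isYes≗does; does-⇔; fromWitness; toWitness)
open import Relation.Binary.PropositionalEquality
  using (_≡_; _≢_; refl; sym; trans; cong; cong₂; subst; _≗_; module ≡-Reasoning)

open Equivalence using (to; from)

∨-redundant-middle : ∀ a b c → (T b → T a) → a ∨ (b ∨ c) ≡ a ∨ c
∨-redundant-middle true  b     c _ = refl
∨-redundant-middle false false c _ = refl
∨-redundant-middle false true  c h with h _
... | ()

∨-redundantˡ : ∀ a b → (T a → T b) → a ∨ b ≡ b
∨-redundantˡ false b     _ = refl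
∨-redundantˡ true  true  _ = refl
∨-redundantˡ true  false h with h _
... | ()

map-allFin-suc : ∀ {a} {A : Set a} {m} (f : Fin (suc m) → A) →
  map f (allFin (suc m)) ≡ f zero ∷ map (f ∘ suc) (allFin m)
map-allFin-suc f = trans (map-tabulate id f) (cong (f zero ∷_) (sym (map-tabulate id (f ∘ suc))))

any-allFin-suc : ∀ {m} (p : Fin (suc m) → Bool) →
  any p (allFin (suc m)) ≡ p zero ∨ any (p ∘ suc) (allFin m)
any-allFin-suc p = cong or (map-allFin-suc p)

sum-allFin-suc : ∀ {m} (f : Fin (suc m) → ℕ) →
  sum (map f (allFin (suc m))) ≡ f zero ℕ.+ sum (map (f ∘ suc) (allFin m))
sum-allFin-suc f = cong sum (map-allFin-suc f)

any-cong : ∀ {a} {A : Set a} {p q : A → Bool} → p ≗ q → ∀ xs → any p xs ≡ any q xs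
any-cong p≗q xs = cong or (map-cong p≗q xs)

any-const-false : ∀ {a} {A : Set a} (xs : List A) → any (λ _ → false) xs ≡ false
any-const-false []       = refl
any-const-false (_ ∷ xs) = any-const-false xs

⌊⌋-⇔ : ∀ {a b} {A : Set a} {B : Set b} → A ⇔ B → (a? : Dec A) (b? : Dec B) → ⌊ a? ⌋ ≡ ⌊ b? ⌋
⌊⌋-⇔ A⇔B a? b? = trans (isYes≗does a?) (trans (does-⇔ A⇔B a? b?) (sym (isYes≗does b?)))

suc≟suc : ∀ {m} (v w : Fin m) → ⌊ suc v ≟ suc w ⌋ ≡ ⌊ v ≟ w ⌋
suc≟suc v w = ⌊⌋-⇔ (mk⇔ suc-injective (cong suc)) (suc v ≟ suc w) (v ≟ w)

any-∧-≟ : ∀ {m} (p : Fin m → Bool) w → any (λ v → p v ∧ ⌊ v ≟ w ⌋) (allFin m) ≡ p w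
any-∧-≟ {suc m} p zero = begin
  any (λ v → p v ∧ ⌊ v ≟ zero ⌋) (allFin (suc m)) ≡⟨ any-allFin-suc (λ v → p v ∧ ⌊ v ≟ zero ⌋) ⟩
  p zero ∧ true ∨ any (λ v → p (suc v) ∧ false) (allFin m)
    ≡⟨ cong₂ _∨_ (∧-identityʳ (p zero))
                 (trans (any-cong (∧-zeroʳ ∘ p ∘ suc) (allFin m)) (any-const-false (allFin m))) ⟩
  p zero ∨ false ≡⟨ ∨-identityʳ (p zero) ⟩
  p zero ∎
  where open ≡-Reasoning
any-∧-≟ {suc m} p (suc w) = begin
  any (λ v → p v ∧ ⌊ v ≟ suc w ⌋) (allFin (suc m)) ≡⟨ any-allFin-suc (λ v → p v ∧ ⌊ v ≟ suc w ⌋) ⟩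
  p zero ∧ false ∨ any (λ v → p (suc v) ∧ ⌊ suc v ≟ suc w ⌋) (allFin m)
    ≡⟨ cong₂ _∨_ (∧-zeroʳ (p zero)) (any-cong (λ v → cong (p (suc v) ∧_) (suc≟suc v w)) (allFin m)) ⟩
  any (λ v → p (suc v) ∧ ⌊ v ≟ w ⌋) (allFin m) ≡⟨ any-∧-≟ (p ∘ suc) w ⟩
  p (suc w) ∎
  where open ≡-Reasoning

sum-map-suc : ∀ {a} {A : Set a} (f : A → ℕ) xs → sum (map (suc ∘ f) xs) ≡ length xs ℕ.+ sum (map f xs)
sum-map-suc f []       = refl
sum-map-suc f (x ∷ xs) = cong suc (trans (cong (f x ℕ.+_) (sum-map-suc f xs)) (x∙yz≈y∙xz (f x) (length xs) _))

least-cong : ∀ {p q : ℕ → Bool} → p ≗ q → ∀ s f → least p s f ≡ least q s f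
least-cong p≗q s zero    = refl
least-cong {p} {q} p≗q s (suc f) with p s | q s | p≗q s
... | true  | _ | refl = refl
... | false | _ | refl = least-cong p≗q (suc s) f

least-suc-start : ∀ (p : ℕ → Bool) s f → least p (suc s) f ≡ suc (least (p ∘ suc) s f)
least-suc-start p s zero    = refl
least-suc-start p s (suc f) with p (suc s)
... | true  = refl
... | false = least-suc-start p (suc s) f

least-hit : ∀ (p : ℕ → Bool) s f → T (p s) → least p s (suc f) ≡ s
least-hit p s f ps with p s | ps
... | true | _ = refl

least-suc-fuel : ∀ (p : ℕ → Bool) {k} s f → T (p k) → s ≤ k → k < s ℕ.+ f → least p s (suc f) ≡ least p s f
least-suc-fuel p s zero    _  s≤k k<s+0 =
  contradiction (<-≤-trans (subst (_ <_) (+-identityʳ s) k<s+0) s≤k) (<-irrefl refl)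
least-suc-fuel p {k} s (suc f) pk s≤k k<s+f with p s in ps≡
... | true  = refl
... | false = least-suc-fuel p (suc s) f pk (≤∧≢⇒< s≤k s≢k) (subst (k <_) (+-suc s f) k<s+f)
  where
  s≢k : s ≢ k
  s≢k refl = subst T ps≡ pk

module _ {m} (H : Graph m) where

  reach-refl : ∀ k x → T (reach H k x x)
  reach-refl zero    x = fromWitness refl
  reach-refl (suc k) x = from T-∨ (inj₁ (reach-refl k x))

  reach-mono : ∀ k {x y} → T (reach H k x y) → T (reach H (suc k) x y)
  reach-mono k r = from T-∨ (inj₁ r)

  reach-snoc : ∀ k {x y z} → T (reach H k x y) → T (adj H y z) → T (reach H (suc k) x z)
  reach-snoc k {y = y} r a = from T-∨ (inj₂ (any⁺ _ (lose (∈-allFin y) (from T-∧ (r , a)))))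

  reach-cons : ∀ k {x y z} → T (adj H x y) → T (reach H k y z) → T (reach H (suc k) x z)
  reach-cons zero a r with toWitness r
  ... | refl = reach-snoc zero (reach-refl zero _) a
  reach-cons (suc k) {y = y} {z} a r with to T-∨ r
  ... | inj₁ r′ = reach-mono (suc k) (reach-cons k a r′)
  ... | inj₂ s with satisfied (any⁻ (λ v → reach H k y v ∧ adj H v z) (allFin m) s)
  ... | _ , t with to T-∧ t
  ... | r′ , a′ = reach-snoc (suc k) (reach-cons k a r′) a′

  walk⇒reach : ∀ {x y k} → Walk H x y k → T (reach H k x y)
  walk⇒reach (stop x)   = reach-refl zero x
  walk⇒reach (step {y = y} {k = k} a w) = reach-cons k {y = y} (from T-≡ a) (walk⇒reach w)

dist-self : ∀ {m} (H : Graph m) x → dist H x x ≡ 0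
dist-self {suc m} H x = least-hit (λ k → reach H k x x) 0 m (reach-refl H 0 x)

reach-cong : ∀ {m} {H₁ H₂ : Graph m} → (∀ a b → adj H₁ a b ≡ adj H₂ a b) →
  ∀ k x y → reach H₁ k x y ≡ reach H₂ k x y
reach-cong same zero    x y = refl
reach-cong same (suc k) x y =
  cong₂ _∨_ (reach-cong same k x y)
            (any-cong (λ v → cong₂ _∧_ (reach-cong same k x v) (same v y)) (allFin _))

transmission-cong : ∀ {m} {H₁ H₂ : Graph m} → (∀ a b → adj H₁ a b ≡ adj H₂ a b) →
  ∀ x → transmission H₁ x ≡ transmission H₂ x
transmission-cong {m} {H₁} {H₂} same x =
  cong sum (map-cong dist-cong (allFin m))
  where
  dist-cong : ∀ y → dist H₁ x y ≡ dist H₂ x y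
  dist-cong y = least-cong (λ k → reach-cong same k x y) 0 m

module _ {m} {H : Graph m} where

  vertexAt : ∀ {x y k} → Walk H x y k → ℕ → Fin m
  vertexAt (stop x)       _       = x
  vertexAt {x} (step _ _) zero    = x
  vertexAt (step _ w)     (suc p) = vertexAt w p

  walkPrefix : ∀ {x y k} (w : Walk H x y k) p → p ≤ k → Walk H x (vertexAt w p) p
  walkPrefix (stop x)       zero    _         = stop x
  walkPrefix {x} (step _ _) zero    _         = stop x
  walkPrefix (step a w)     (suc p) (s≤s p≤k) = step a (walkPrefix w p p≤k)

  walkSuffix : ∀ {x y k} (w : Walk H x y k) p → p ≤ k → Walk H (vertexAt w p) y (k ∸ p)
  walkSuffix (stop x)   zero    _         = stop x
  walkSuffix (step a w) zero    _         = step a w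
  walkSuffix (step _ w) (suc p) (s≤s p≤k) = walkSuffix w p p≤k

  _++ʷ_ : ∀ {x y z a b} → Walk H x y a → Walk H y z b → Walk H x z (a ℕ.+ b)
  stop _   ++ʷ w′ = w′
  step a w ++ʷ w′ = step a (w ++ʷ w′)

  -- The k + 1 > m positions of the walk cannot carry distinct vertices; cut out the loop between a repeat.
  walk-shorten : ∀ {x y k} → m ≤ k → Walk H x y k → ∃ λ k′ → k′ < k × Walk H x y k′
  walk-shorten {x} {y} {k} m≤k w with pigeonhole (s≤s m≤k) (vertexAt w ∘ toℕ)
  ... | i , j , i<j , same = toℕ i ℕ.+ (k ∸ toℕ j) , shorter , walkPrefix w (toℕ i) i≤k ++ʷ suffix
    where
    j≤k : toℕ j ≤ k
    j≤k = toℕ≤pred[n] j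
    i≤k : toℕ i ≤ k
    i≤k = ≤-trans (<⇒≤ i<j) j≤k
    suffix : Walk H (vertexAt w (toℕ i)) y (k ∸ toℕ j)
    suffix = subst (λ v → Walk H v y (k ∸ toℕ j)) (sym same) (walkSuffix w (toℕ j) j≤k)
    shorter : toℕ i ℕ.+ (k ∸ toℕ j) < k
    shorter = subst (toℕ i ℕ.+ (k ∸ toℕ j) <_) (m+[n∸m]≡n j≤k) (+-monoˡ-< (k ∸ toℕ j) i<j)

  walk-within : ∀ {x y k} → Walk H x y k → ∃ λ k′ → k′ < m × Walk H x y k′
  walk-within w = go (<-wellFounded _) w
    where
    go : ∀ {x y k} → Acc _<_ k → Walk H x y k → ∃ λ k′ → k′ < m × Walk H x y k′
    go {k = k} (acc rec) w with k <? m
    ... | yes k<m = k , k<m , w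
    ... | no  k≮m with walk-shorten (≮⇒≥ k≮m) w
    ... | _ , k′<k , w′ = go (rec k′<k) w′

-- In a connected graph every distance is below m, so searching one step further changes nothing.
least-reach-suc-fuel : ∀ {m} (H : Graph m) → Connected H →
  ∀ x y → least (λ k → reach H k x y) 0 (suc m) ≡ dist H x y
least-reach-suc-fuel H connected x y with walk-within (proj₂ (connected x y))
... | k , k<m , w = least-suc-fuel (λ k → reach H k x y) 0 _ (walk⇒reach H w) z≤n k<m

reach-suc-via-zero : ∀ {m} (H : Graph (suc m)) k x y →
  reach H (suc k) x y
    ≡ reach H k x y
      ∨ (reach H k x zero ∧ adj H zero y ∨ any (λ v → reach H k x (suc v) ∧ adj H (suc v) y) (allFin m))
reach-suc-via-zero H k x y = cong (reach H k x y ∨_) (any-allFin-suc (λ v → reach H k x v ∧ adj H v y))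

module _ {m} (H : Graph m) (w : Fin m) where

  private
    H⁺ : Graph (suc m)
    H⁺ = addPendant H w

  reach-from-pendant : ∀ k j → reach H⁺ (suc k) zero (suc j) ≡ reach H k w j
  reach-from-pendant zero j = begin
    reach H⁺ 1 zero (suc j)                   ≡⟨ reach-suc-via-zero H⁺ 0 zero (suc j) ⟩
    ⌊ j ≟ w ⌋ ∨ any (λ _ → false) (allFin m)  ≡⟨ cong (⌊ j ≟ w ⌋ ∨_) (any-const-false (allFin m)) ⟩
    ⌊ j ≟ w ⌋ ∨ false                         ≡⟨ ∨-identityʳ _ ⟩
    ⌊ j ≟ w ⌋                                 ≡⟨ ⌊⌋-⇔ (mk⇔ sym sym) (j ≟ w) (w ≟ j) ⟩
    ⌊ w ≟ j ⌋                                 ∎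
    where open ≡-Reasoning
  reach-from-pendant (suc k) j = begin
    reach H⁺ (suc (suc k)) zero (suc j)
      ≡⟨ reach-suc-via-zero H⁺ (suc k) zero (suc j) ⟩
    reach H⁺ (suc k) zero (suc j)
      ∨ (reach H⁺ (suc k) zero zero ∧ ⌊ j ≟ w ⌋
         ∨ any (λ v → reach H⁺ (suc k) zero (suc v) ∧ adj H v j) (allFin m))
      ≡⟨ cong₂ (λ a c → a ∨ (reach H⁺ (suc k) zero zero ∧ ⌊ j ≟ w ⌋ ∨ c))
               (reach-from-pendant k j)
               (any-cong (λ v → cong (_∧ adj H v j) (reach-from-pendant k v)) (allFin m)) ⟩
    reach H k w j ∨ (reach H⁺ (suc k) zero zero ∧ ⌊ j ≟ w ⌋ ∨ any (λ v → reach H k w v ∧ adj H v j) (allFin m))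
      ≡⟨ ∨-redundant-middle _ _ _ via-pendant-edge ⟩
    reach H (suc k) w j ∎
    where
    open ≡-Reasoning
    via-pendant-edge : T (reach H⁺ (suc k) zero zero ∧ ⌊ j ≟ w ⌋) → T (reach H k w j)
    via-pendant-edge t with toWitness {a? = j ≟ w} (proj₂ (to T-∧ t))
    ... | refl = reach-refl H k w

  reach-between-old  : ∀ k i j → reach H⁺ k (suc i) (suc j) ≡ reach H k i j
  reach-to-pendant   : ∀ k i → reach H⁺ (suc k) (suc i) zero ≡ reach H k i w
  reach-to-pendant⇒ : ∀ k i → T (reach H⁺ k (suc i) zero) → T (reach H k i w)

  reach-between-old zero    i j = suc≟suc i j
  reach-between-old (suc k) i j = begin
    reach H⁺ (suc k) (suc i) (suc j)
      ≡⟨ reach-suc-via-zero H⁺ k (suc i) (suc j) ⟩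
    reach H⁺ k (suc i) (suc j)
      ∨ (reach H⁺ k (suc i) zero ∧ ⌊ j ≟ w ⌋ ∨ any (λ v → reach H⁺ k (suc i) (suc v) ∧ adj H v j) (allFin m))
      ≡⟨ cong₂ (λ a c → a ∨ (reach H⁺ k (suc i) zero ∧ ⌊ j ≟ w ⌋ ∨ c))
               (reach-between-old k i j)
               (any-cong (λ v → cong (_∧ adj H v j) (reach-between-old k i v)) (allFin m)) ⟩
    reach H k i j ∨ (reach H⁺ k (suc i) zero ∧ ⌊ j ≟ w ⌋ ∨ any (λ v → reach H k i v ∧ adj H v j) (allFin m))
      ≡⟨ ∨-redundant-middle _ _ _ via-pendant ⟩
    reach H (suc k) i j ∎
    where
    open ≡-Reasoning
    via-pendant : T (reach H⁺ k (suc i) zero ∧ ⌊ j ≟ w ⌋) → T (reach H k i j)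
    via-pendant t with to T-∧ t
    ... | r , j≟w with toWitness {a? = j ≟ w} j≟w
    ... | refl = reach-to-pendant⇒ k i r

  reach-to-pendant k i = begin
    reach H⁺ (suc k) (suc i) zero
      ≡⟨ reach-suc-via-zero H⁺ k (suc i) zero ⟩
    reach H⁺ k (suc i) zero
      ∨ (reach H⁺ k (suc i) zero ∧ false ∨ any (λ v → reach H⁺ k (suc i) (suc v) ∧ ⌊ v ≟ w ⌋) (allFin m))
      ≡⟨ cong₂ (λ b c → reach H⁺ k (suc i) zero ∨ (b ∨ c))
               (∧-zeroʳ (reach H⁺ k (suc i) zero))
               (any-cong (λ v → cong (_∧ ⌊ v ≟ w ⌋) (reach-between-old k i v)) (allFin m)) ⟩
    reach H⁺ k (suc i) zero ∨ any (λ v → reach H k i v ∧ ⌊ v ≟ w ⌋) (allFin m)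
      ≡⟨ cong (reach H⁺ k (suc i) zero ∨_) (any-∧-≟ (reach H k i) w) ⟩
    reach H⁺ k (suc i) zero ∨ reach H k i w
      ≡⟨ ∨-redundantˡ _ _ (reach-to-pendant⇒ k i) ⟩
    reach H k i w ∎
    where open ≡-Reasoning

  reach-to-pendant⇒ zero    i ()
  reach-to-pendant⇒ (suc k) i r = reach-mono H k (subst T (reach-to-pendant k i) r)

  dist-from-pendant : ∀ j → dist H⁺ zero (suc j) ≡ suc (dist H w j)
  dist-from-pendant j = trans (least-suc-start (λ k → reach H⁺ k zero (suc j)) 0 m)
                              (cong suc (least-cong (λ k → reach-from-pendant k j) 0 m))

  dist-to-pendant : ∀ i → dist H⁺ (suc i) zero ≡ suc (dist H i w)
  dist-to-pendant i = trans (least-suc-start (λ k → reach H⁺ k (suc i) zero) 0 m)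
                            (cong suc (least-cong (λ k → reach-to-pendant k i) 0 m))

  dist-between-old : Connected H → ∀ i j → dist H⁺ (suc i) (suc j) ≡ dist H i j
  dist-between-old connected i j = trans (least-cong (λ k → reach-between-old k i j) 0 (suc m))
                                         (least-reach-suc-fuel H connected i j)

  transmission-pendant : transmission H⁺ zero ≡ m ℕ.+ transmission H w
  transmission-pendant = begin
    transmission H⁺ zero                       ≡⟨ sum-allFin-suc (dist H⁺ zero) ⟩
    sum (map (dist H⁺ zero ∘ suc) (allFin m))  ≡⟨ cong sum (map-cong dist-from-pendant (allFin m)) ⟩
    sum (map (suc ∘ dist H w) (allFin m))      ≡⟨ sum-map-suc (dist H w) (allFin m) ⟩
    length (allFin m) ℕ.+ transmission H w     ≡⟨ cong (ℕ._+ transmission H w) (length-tabulate id) ⟩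
    m ℕ.+ transmission H w                     ∎
    where open ≡-Reasoning

  transmission-old : Connected H → ∀ x → transmission H⁺ (suc x) ≡ suc (dist H x w) ℕ.+ transmission H x
  transmission-old connected x =
    trans (sum-allFin-suc (dist H⁺ (suc x)))
          (cong₂ ℕ._+_ (dist-to-pendant x) (cong sum (map-cong (dist-between-old connected x) (allFin m))))

+[k+a]-+[k+b]≡+a-+b : ∀ k a b → + (k ℕ.+ a) - + (k ℕ.+ b) ≡ + a - + b
+[k+a]-+[k+b]≡+a-+b k a b = trans (m-n≡m⊖n (k ℕ.+ a) (k ℕ.+ b)) (trans (+-cancelˡ-⊖ k a b) (sym (m-n≡m⊖n a b)))

+[1+k+a]-+[k+b]≡+a-+b+1 : ∀ k a b → + (suc k ℕ.+ a) - + (k ℕ.+ b) ≡ (+ a - + b) + 1ℤ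
+[1+k+a]-+[k+b]≡+a-+b+1 k a b rewrite pos-+ (suc k) a | pos-+ k b | pos-+ 1 k = ring-identity (+ k) (+ a) (+ b)
  where
  ring-identity : ∀ x y z → (1ℤ + x) + y - (x + z) ≡ (y - z) + 1ℤ
  ring-identity = solve-∀

punchIn≡⇔≡punchOut : ∀ {n} {v u : Fin (suc n)} (v≢u : v ≢ u) (j : Fin n) →
  (punchIn v j ≡ u) ⇔ (j ≡ punchOut v≢u)
punchIn≡⇔≡punchOut {v = v} v≢u j = mk⇔
  (λ eq → trans (sym (punchOut-punchIn v)) (punchOut-cong v eq))
  (λ eq → trans (cong (punchIn v) eq) (punchIn-punchOut v≢u))

module _ {n} (G : Graph (suc n)) {v u : Fin (suc n)} (v≢u : v ≢ u) where

  private
    G⁺ : Graph (suc (suc n))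
    G⁺ = addPendant G u
    G-v : Graph n
    G-v = deleteVertex G v
    u′ : Fin n
    u′ = punchOut v≢u

  adj-deleteVertex-addPendant : ∀ a b → adj (deleteVertex G⁺ (suc v)) a b ≡ adj (addPendant G-v u′) a b
  adj-deleteVertex-addPendant zero    zero    = refl
  adj-deleteVertex-addPendant zero    (suc j) = ⌊⌋-⇔ (punchIn≡⇔≡punchOut v≢u j) (punchIn v j ≟ u) (j ≟ u′)
  adj-deleteVertex-addPendant (suc i) zero    = ⌊⌋-⇔ (punchIn≡⇔≡punchOut v≢u i) (punchIn v i ≟ u) (i ≟ u′)
  adj-deleteVertex-addPendant (suc i) (suc j) = refl

  transmission-deleteVertex-addPendant : ∀ x →
    transmission (deleteVertex G⁺ (suc v)) x ≡ transmission (addPendant G-v u′) x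
  transmission-deleteVertex-addPendant = transmission-cong adj-deleteVertex-addPendant

  δ-pendant : δ G⁺ (suc v) zero (λ ()) ≡ δ G v u v≢u + 1ℤ
  δ-pendant = begin
    + transmission G⁺ zero - + transmission (deleteVertex G⁺ (suc v)) zero
      ≡⟨ cong₂ (λ a b → + a - + b)
               (transmission-pendant G u)
               (trans (transmission-deleteVertex-addPendant zero) (transmission-pendant G-v u′)) ⟩
    + (suc n ℕ.+ transmission G u) - + (n ℕ.+ transmission G-v u′)
      ≡⟨ +[1+k+a]-+[k+b]≡+a-+b+1 n (transmission G u) (transmission G-v u′) ⟩
    δ G v u v≢u + 1ℤ ∎
    where open ≡-Reasoning

  δ-old : Connected G → Connected G-v → δ G⁺ (suc v) (suc u) (λ e → v≢u (suc-injective e)) ≡ δ G v u v≢u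
  δ-old connected connected-v = begin
    δ G⁺ (suc v) (suc u) (λ e → v≢u (suc-injective e))
      ≡⟨ cong₂ (λ a b → + a - + b) (transmission-old G u connected u) transmission-G⁺-v ⟩
    + (suc (dist G u u) ℕ.+ transmission G u) - + (suc (dist G-v u′ u′) ℕ.+ transmission G-v u′)
      ≡⟨ cong₂ (λ d d′ → + (suc d ℕ.+ transmission G u) - + (suc d′ ℕ.+ transmission G-v u′))
               (dist-self G u) (dist-self G-v u′) ⟩
    + (1 ℕ.+ transmission G u) - + (1 ℕ.+ transmission G-v u′)
      ≡⟨ +[k+a]-+[k+b]≡+a-+b 1 (transmission G u) (transmission G-v u′) ⟩
    δ G v u v≢u ∎
    where
    open ≡-Reasoning
    transmission-G⁺-v : transmission (deleteVertex G⁺ (suc v)) (punchOut {i = suc v} (λ e → v≢u (suc-injective e)))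
                          ≡ suc (dist G-v u′ u′) ℕ.+ transmission G-v u′
    transmission-G⁺-v = begin
      transmission (deleteVertex G⁺ (suc v)) (suc (punchOut (λ e → v≢u (suc-injective (cong suc e)))))
        ≡⟨ cong (transmission (deleteVertex G⁺ (suc v)) ∘ suc) (punchOut-cong v refl) ⟩
      transmission (deleteVertex G⁺ (suc v)) (suc u′)
        ≡⟨ transmission-deleteVertex-addPendant (suc u′) ⟩
      transmission (addPendant G-v u′) (suc u′)
        ≡⟨ transmission-old G-v u′ connected-v u′ ⟩
      suc (dist G-v u′ u′) ℕ.+ transmission G-v u′ ∎

lemma1 : ∀ {n : ℕ} (G : Graph (suc n)) (v₁ u : Fin (suc n))
    → Connected G
    → Connected (deleteVertex G v₁)
    → (v₁≢u : v₁ ≢ u)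
    → (δ (addPendant G u) (suc v₁) zero (λ ())
         ≡ δ (addPendant G u) (suc v₁) (suc u) (λ e → v₁≢u (suc-injective e)) + 1ℤ)
      × (δ (addPendant G u) (suc v₁) (suc u) (λ e → v₁≢u (suc-injective e)) + 1ℤ
         ≡ δ G v₁ u v₁≢u + 1ℤ)
lemma1 G v₁ u connected connected-v₁ v₁≢u =
  trans (δ-pendant G v₁≢u) (cong (_+ 1ℤ) (sym δ-old-u)) , cong (_+ 1ℤ) δ-old-u
  where
  δ-old-u : δ (addPendant G u) (suc v₁) (suc u) (λ e → v₁≢u (suc-injective e)) ≡ δ G v₁ u v₁≢u
  δ-old-u = δ-old G v₁≢u connected connected-v₁
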